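{- Let $E$ be a binary smooth relation on $\mathbb{Q}^k$ that is preserved by $\langle pp\rangle$, and assume that $E$ contains a min-clean tuple $\binom{u^1}{v^1}$. Then there exist $I\subseteq [k]$, $m,n\ge 1$, $q\in\mathbb{Q}$, and $\binom{u^2}{v^2},\dots,\binom{u^n}{v^n}\in E$ such that for all $u,v\in\mathbb{Q}^k$ the tuple defined by $\binom{u'}{v'}:=pp_q^{(n+1)}\left(\binom{u^1}{v^1},\dots,\binom{u^n}{v^n},\binom{u}{v}\right)$ satisfies: (i) $I_m(u')=I_m(v')=I$ and $u'\sim_I v'$; (ii) $u'\sim_{[k]\setminus I}u$ and $v'\sim_{[k]\setminus I}v$.
   Context: $[k]=\{1,\dots,k\}$. For $a\in\mathbb{Q}^k$: $\min(a)$ is its minimal entry, $\mathrm{minx}(a)=\{i\in[k]:a_i=\min(a)\}$, and for $1\le m\le k$, $I_m(a)$ is the set of indices $i$ such that $a_i$ is among the $m$ smallest values appearing in $a$. For $a,b\in\mathbb{Q}^\ell$, $a\sim_\ell b$ iff $a_i\le a_j\Leftrightarrow b_i\le b_j$ for all $i,j$; for $I\subseteq[k]$, $a\sim_I b$ iff the subtuples of $a,b$ on coordinates in $I$ satisfy $\sim_{|I|}$. A binary relation on $\mathbb{Q}^k$ is a nonempty $E\subseteq\mathbb{Q}^k\times\mathbb{Q}^k$ (identified with a subset of $\mathbb{Q}^{2k}$); it is smooth if $\{a:(a,b)\in E\}=\{b:(a,b)\in E\}$. For $t=(t_1,t_2)\in E$, let $\min(t)$ be the minimal entry among all entries of $t_1,t_2$,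 $M(t)=\{i:\min(t_i)=\min(t)\}$; $t$ is min-clean if $\mathrm{minx}(t_i)=\mathrm{minx}(t_j)$ for all $i,j\in M(t)$. Operations on $\mathbb{Q}$ act on tuples componentwise; a relation is preserved by $f$ if it is closed under componentwise application of $f$. For $q\in\mathbb{Q}$, $pp_q:\mathbb{Q}^2\to\mathbb{Q}$ denotes a binary operation with $pp_q(x,y)\le pp_q(x',y')$ iff ($x\le q$ and $x\le x'$) or ($x,x'>q$ and $y\le y'$); $pp=pp_0$. For a set $F$ of operations on $\mathbb{Q}$, $\langle F\rangle$ is the smallest set of finitary operations on $\mathbb{Q}$ containing $F$, all automorphisms of $(\mathbb{Q};<)$ and all projections, closed under composition, and closed under interpolation (an operation $g$ belongs to it whenever for each finite $A\subseteq\mathbb{Q}$ some member agrees with $g$ on $A$); "preserved by $\langle f\rangle$" means preserved by every operation in $\langle\{f\}\rangle$. For binary $f$, $f^{(m)}(x_1,\dots,x_m)=f(x_1,f(x_2,\dots,f(x_{m-1},x_m)\dots))$. -}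

module Defs where

open import Data.Nat using (ℕ; zero; suc; _+_)
open import Data.Fin using (Fin)
open import Data.Fin.Subset using (Subset; _∈_; _∉_)
open import Data.Rational using (ℚ; _≤_; _<_; 0ℚ)
open import Data.List using (List)
import Data.List.Membership.Propositional as LM
open import Data.Vec using (Vec; []; _∷_; _++_; tabulate)
open import Data.Product using (Σ; ∃; _×_; _,_; proj₁; proj₂)
open import Data.Sum using (_⊎_)
open import Relation.Binary.PropositionalEquality using (_≡_)
open import Relation.Nullary using (¬_)
open import Function using (_⇔_; _∘_)
open import Function.Definitions using (Injective)

Tup : ℕ → Set
Tup k = Fin k → ℚ

Op : ℕ → Set
Op n = (Fin n → ℚ) → ℚ

IsAut : (ℚ → ℚ) → Set
IsAut α = (∀ x y → (x < y) ⇔ (α x < α y)) × (∀ y → ∃ λ x → α x ≡ y)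

-- ⟨ {f} ⟩ for a binary operation f: smallest set of finitary operations
-- containing f, automorphisms, projections, closed under composition and
-- interpolation.
data Clo (f : ℚ → ℚ → ℚ) : (n : ℕ) → Op n → Set where
  base   : Clo f 2 (λ x → f (x Fin.zero) (x (Fin.suc Fin.zero)))
  aut    : (α : ℚ → ℚ) → IsAut α → Clo f 1 (λ x → α (x Fin.zero))
  proj   : (n : ℕ) (i : Fin n) → Clo f n (λ x → x i)
  comp   : (m n : ℕ) (g : Op m) (hs : Fin m → Op n) →
           Clo f m g → (∀ i → Clo f n (hs i)) →
           Clo f n (λ x → g (λ i → hs i x))
  interp : (n : ℕ) (g : Op n) →
           ((A : List ℚ) → Σ (Op n) λ h → Clo f n h ×
              (∀ (x : Fin n → ℚ) → (∀ i → x i LM.∈ A) → h x ≡ g x)) →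
           Clo f n g

BinRel : ℕ → Set₁
BinRel k = Tup k → Tup k → Set

Smooth : {k : ℕ} → BinRel k → Set
Smooth {k} E = ∀ (a : Tup k) → (∃ λ b → E a b) ⇔ (∃ λ b → E b a)

Preserves : {k : ℕ} (n : ℕ) → Op n → BinRel k → Set
Preserves {k} n g E =
  (ts : Fin n → Tup k × Tup k) → (∀ l → E (proj₁ (ts l)) (proj₂ (ts l))) →
  E (λ j → g (λ l → proj₁ (ts l) j)) (λ j → g (λ l → proj₂ (ts l) j))

PreservedByClo : {k : ℕ} → (ℚ → ℚ → ℚ) → BinRel k → Set
PreservedByClo f E = ∀ n g → Clo f n g → Preserves n g E

IsMin : {k : ℕ} → Tup k → ℚ → Set
IsMin a x = (∃ λ i → a i ≡ x) × (∀ i → x ≤ a i)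

InMinx : {k : ℕ} → Tup k → Fin k → Set
InMinx a i = ∀ j → a i ≤ a j

IsMinPair : {k : ℕ} → Tup k → Tup k → ℚ → Set
IsMinPair u v x = ((∃ λ i → u i ≡ x) ⊎ (∃ λ i → v i ≡ x)) × (∀ i → x ≤ u i × x ≤ v i)

-- t = (u,v) is min-clean: for all components c,d ∈ M(t), minx(c) = minx(d).
-- With two components, the only nontrivial case is when both are in M(t).
MinClean : {k : ℕ} → Tup k → Tup k → Set
MinClean u v = ∀ x → IsMinPair u v x → IsMin u x → IsMin v x →
  ∀ i → InMinx u i ⇔ InMinx v i

-- i ∈ I_m(a): a_i is among the m smallest values appearing in a, i.e.
-- there are not m pairwise distinct values of a strictly below a_i.
InIm : {k : ℕ} → ℕ → Tup k → Fin k → Set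
InIm {k} m a i = (js : Fin m → Fin k) → (∀ l → a (js l) < a i) →
  ¬ Injective _≡_ _≡_ (a ∘ js)

SimOn : {k : ℕ} → (Fin k → Set) → Tup k → Tup k → Set
SimOn P a b = ∀ i j → P i → P j → (a i ≤ a j) ⇔ (b i ≤ b j)

IsPPq : ℚ → (ℚ → ℚ → ℚ) → Set
IsPPq q f = ∀ x y x' y' →
  (f x y ≤ f x' y') ⇔ ((x ≤ q × x ≤ x') ⊎ (q < x × q < x' × y ≤ y'))

iterOp : {m : ℕ} → (ℚ → ℚ → ℚ) → Vec ℚ (suc m) → ℚ
iterOp f (x ∷ []) = x
iterOp f (x ∷ y ∷ xs) = f x (iterOp f (y ∷ xs))

-- pp_q^{(n'+2)} applied coordinatewise to the tuples w¹, w², …, w^{n'+1}, w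
-- (here w¹ is given separately, ws lists w², …, w^{n'+1})
applyIter : {k n' : ℕ} → (ℚ → ℚ → ℚ) → Tup k → (Fin n' → Tup k) → Tup k → Tup k
applyIter f w1 ws w j = iterOp f (w1 j ∷ (tabulate (λ l → ws l j) ++ (w j ∷ [])))

{-# OPTIONS --safe #-}
-- Let q be the least entry of (u¹, v¹). Whether pp_q(x, y) ≤ pp_q(x′, y′) holds is decided by
-- x, x′ as soon as x ≤ q, and by y, y′ when x, x′ > q. So in pp_q(c₀, pp_q(c₁, … pp_q(c_n, y)))
-- a coordinate one of whose c's is ≤ q is frozen: frozen coordinates lie below all others and
-- keep their mutual order whatever y is, while the unfrozen ones are ordered like y.
-- If q is attained in both u¹ and v¹, min-cleanness says that pp_q(u¹, ·) and pp_q(v¹, ·) freeze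
-- the same coordinates. If q is attained only in u¹, smoothness gives a backward path
-- u¹ = x₀ ← x₁ ← x₂ ← ⋯ in E; feeding (x₁, x₀), (x₂, x₁), … into the two rows makes the v-row
-- the u-row delayed by one step behind v¹ > q. The frozen set of the u-row grows with its length
-- inside [k], so it stabilises; from then on both rows freeze the same set I in the same order,
-- and m is the number of values taken on I. If q is attained only in v¹, swap u and v.
module Submission where

open import Defs
open import Data.Nat using (ℕ; zero; suc; _≤′_; ≤′-refl; ≤′-step)
import Data.Nat as ℕ
open import Data.Nat.Properties using (≤⇒≤′; n<1+n; 1+n≰n)
open import Data.Fin using (Fin; zero; suc; toℕ)
open import Data.Fin.Properties using (any?; all?; ¬∀⟶∃¬; injective⇒≤; pigeonhole)
open import Data.Fin.Subset using (Subset; _∈_; _∉_)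
open import Data.Rational using (ℚ; 0ℚ; _≤_; _<_; _≟_; _≤?_)
open import Data.Rational.Properties
  using (≤-trans; ≤-reflexive; ≤-antisym; ≰⇒>; <-irrefl; <-asym; <-≤-trans; <-cmp; ≤-decTotalOrder)
open import Data.List using (allFin)
import Data.List.Relation.Unary.All as All
open import Data.List.Membership.Propositional.Properties using (∈-allFin)
open import Relation.Binary.Bundles using (DecTotalOrder)
open import Data.List.Extrema (DecTotalOrder.totalOrder ≤-decTotalOrder) using (argmin; f[argmin]≤f[xs])
open import Data.Vec using ([]; _∷_; _++_; tabulate)
open import Data.Vec.Properties using (lookup∘tabulate; []=⇒lookup; lookup⇒[]=)
import Data.Vec.Functional as Vector
open import Data.Product using (Σ; ∃; _×_; _,_; proj₁; proj₂; swap)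
open import Data.Sum using (_⊎_; inj₁; inj₂; [_,_])
open import Data.Empty using (⊥-elim)
open import Relation.Nullary using (¬_; Dec; yes; no; does; ¬?)
open import Relation.Nullary.Decidable using (decidable-stable; _⊎-dec_; _×-dec_)
open import Relation.Unary using (Decidable)
open import Relation.Binary using (tri<; tri≈; tri>)
open import Relation.Binary.PropositionalEquality using (_≡_; refl; sym; trans; cong; subst; subst₂)
open import Function using (_⇔_; mk⇔; Equivalence; _∘_; id; const; flip; case_of_)
open import Function.Definitions using (Injective)
import Function.Properties.Equivalence as ⇔

open Equivalence using (to; from)

private
  variable
    k m n : ℕ
    P Q : Fin k → Set
    a b u v u′ v′ : Tup k

<⇒≱ : ∀ {x y} → x < y → ¬ (y ≤ x)
<⇒≱ x<y y≤x = <-irrefl refl (<-≤-trans x<y y≤x)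

fromDec : {P : Fin k → Set} → Decidable P → Subset k
fromDec P? = tabulate (does ∘ P?)

∈-fromDec : {P : Fin k → Set} (P? : Decidable P) (i : Fin k) → (i ∈ fromDec P?) ⇔ P i
∈-fromDec P? i with P? i | lookup∘tabulate (does ∘ P?) i
... | yes p | lookup≡true  = mk⇔ (const p) (λ _ → lookup⇒[]= i _ lookup≡true)
... | no ¬p | lookup≡false =
  mk⇔ (λ i∈ → case trans (sym lookup≡false) ([]=⇒lookup i∈) of λ ()) (⊥-elim ∘ ¬p)

SimOn-sym : SimOn P a b → SimOn P b a
SimOn-sym sim i j pᵢ pⱼ = ⇔.sym (sim i j pᵢ pⱼ)

SimOn-restrict : (∀ {i} → Q i → P i) → SimOn P a b → SimOn Q a b
SimOn-restrict Q⊆P sim i j qᵢ qⱼ = sim i j (Q⊆P qᵢ) (Q⊆P qⱼ)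

SimOn-≡ : SimOn P a b → ∀ {i j} → P i → P j → a i ≡ a j → b i ≡ b j
SimOn-≡ sim pᵢ pⱼ aᵢ≡aⱼ =
  ≤-antisym (to (sim _ _ pᵢ pⱼ) (≤-reflexive aᵢ≡aⱼ)) (to (sim _ _ pⱼ pᵢ) (≤-reflexive (sym aᵢ≡aⱼ)))

record DistinctValues {k : ℕ} (P : Fin k → Set) (a : Tup k) (m : ℕ) : Set where
  field
    index    : Fin m → Fin k
    index∈P  : ∀ r → P (index r)
    distinct : Injective _≡_ _≡_ (a ∘ index)
    covers   : ∀ {i} → P i → ∃ λ r → a i ≡ a (index r)

open DistinctValues

module _ {P : Fin (suc k) → Set} {a : Tup (suc k)} (D : DistinctValues (P ∘ suc) (a ∘ suc) m) where

  private
    Repeated : Set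
    Repeated = ∃ λ r → a zero ≡ a (suc (index D r))

  DistinctValues-skip : (P zero → Repeated) → DistinctValues P a m
  DistinctValues-skip repeated = record
    { index    = suc ∘ index D
    ; index∈P  = index∈P D
    ; distinct = distinct D
    ; covers   = λ { {zero} p → repeated p ; {suc i} p → covers D p }
    }

  DistinctValues-extend : P zero → ¬ Repeated → DistinctValues P a (suc m)
  DistinctValues-extend p₀ new = record
    { index = index′ ; index∈P = index∈P′ ; distinct = distinct′ ; covers = covers′ }
    where
    index′ : Fin (suc m) → Fin (suc k)
    index′ = zero Vector.∷ (suc ∘ index D)
    index∈P′ : ∀ r → P (index′ r)
    index∈P′ zero    = p₀
    index∈P′ (suc r) = index∈P D r
    distinct′ : Injective _≡_ _≡_ (a ∘ index′)
    distinct′ {zero}  {zero}  _ = refl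
    distinct′ {zero}  {suc s} e = ⊥-elim (new (s , e))
    distinct′ {suc r} {zero}  e = ⊥-elim (new (r , sym e))
    distinct′ {suc r} {suc s} e = cong suc (distinct D e)
    covers′ : ∀ {i} → P i → ∃ λ r → a i ≡ a (index′ r)
    covers′ {zero}  _ = zero , refl
    covers′ {suc i} p = suc (proj₁ (covers D p)) , proj₂ (covers D p)

distinctValues : {P : Fin k → Set} → Decidable P → (a : Tup k) → ∃ (DistinctValues P a)
distinctValues {zero} P? a = 0 , record
  { index = λ () ; index∈P = λ () ; distinct = λ { {()} } ; covers = λ { {()} } }
distinctValues {suc k} P? a with distinctValues (P? ∘ suc) (a ∘ suc)
... | m , D with P? zero | any? (λ r → a zero ≟ a (suc (index D r)))
...   | no ¬p₀ | _          = m , DistinctValues-skip D (⊥-elim ∘ ¬p₀)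
...   | yes _  | yes repeat = m , DistinctValues-skip D (const repeat)
...   | yes p₀ | no new     = suc m , DistinctValues-extend D p₀ new

DistinctValues-bound : {P : Fin k → Set} → DistinctValues P a m →
  (τ : Fin n → Fin k) → (∀ r → P (τ r)) → Injective _≡_ _≡_ (a ∘ τ) → n ℕ.≤ m
DistinctValues-bound {a = a} D τ τ∈P τ-distinct = injective⇒≤ λ {r} {s} same →
  τ-distinct (trans (proj₂ (covers D (τ∈P r)))
             (trans (cong (a ∘ index D) same) (sym (proj₂ (covers D (τ∈P s))))))

DistinctValues-transport : {P : Fin k → Set} → SimOn P a b → DistinctValues P a m → DistinctValues P b m
DistinctValues-transport sim D = record
  { index    = index D
  ; index∈P  = index∈P D
  ; distinct = λ e → distinct D (SimOn-≡ (SimOn-sym sim) (index∈P D _) (index∈P D _) e)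
  ; covers   = λ p → proj₁ (covers D p) , SimOn-≡ sim p (index∈P D _) (proj₂ (covers D p))
  }

InIm-lowerBlock : {P : Fin k → Set} → Decidable P → (∀ {i j} → P i → ¬ P j → b i < b j) →
  DistinctValues P b m → ∀ i → InIm m b i ⇔ P i
InIm-lowerBlock {b = b} {m = m} {P = P} P? below D i = mk⇔ inIm⇒P P⇒inIm
  where
  inIm⇒P : InIm m b i → P i
  inIm⇒P inIm = decidable-stable (P? i) λ ¬pᵢ →
    inIm (index D) (λ r → below (index∈P D r) ¬pᵢ) (distinct D)
  -- The m values below b i together with b i itself would be m + 1 distinct values on P.
  P⇒inIm : P i → InIm m b i
  P⇒inIm pᵢ js js<i js-distinct = 1+n≰n (DistinctValues-bound D τ τ∈P τ-distinct)
    where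
    τ : Fin (suc m) → Fin _
    τ = i Vector.∷ js
    τ∈P : ∀ r → P (τ r)
    τ∈P zero    = pᵢ
    τ∈P (suc r) = decidable-stable (P? (js r)) λ ¬p → <-asym (js<i r) (below pᵢ ¬p)
    τ-distinct : Injective _≡_ _≡_ (b ∘ τ)
    τ-distinct {zero}  {zero}  _ = refl
    τ-distinct {zero}  {suc s} e = ⊥-elim (<-irrefl (sym e) (js<i s))
    τ-distinct {suc r} {zero}  e = ⊥-elim (<-irrefl e (js<i r))
    τ-distinct {suc r} {suc s} e = cong suc (js-distinct e)

Splits : (Fin k → Set) → ℕ → (u v u′ v′ : Tup k) → Set
Splits P m u v u′ v′ =
  (∀ i → InIm m u′ i ⇔ P i) × (∀ i → InIm m v′ i ⇔ P i) × SimOn P u′ v′ ×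
  SimOn (λ i → ¬ P i) u′ u × SimOn (λ i → ¬ P i) v′ v

Splits-swap : {P : Fin k → Set} → Splits P m v u v′ u′ → Splits P m u v u′ v′
Splits-swap (inIm-v′ , inIm-u′ , v′∼u′ , v′∼v , u′∼u) =
  inIm-u′ , inIm-v′ , SimOn-sym v′∼u′ , u′∼u , v′∼v

Splits-⇔ : {P Q : Fin k → Set} → (∀ i → P i ⇔ Q i) → Splits P m u v u′ v′ → Splits Q m u v u′ v′
Splits-⇔ P⇔Q (inIm-u′ , inIm-v′ , u′∼v′ , u′∼u , v′∼v) =
  (λ i → ⇔.trans (inIm-u′ i) (P⇔Q i)) , (λ i → ⇔.trans (inIm-v′ i) (P⇔Q i)) ,
  SimOn-restrict (from (P⇔Q _)) u′∼v′ ,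
  SimOn-restrict (λ ¬q p → ¬q (to (P⇔Q _) p)) u′∼u ,
  SimOn-restrict (λ ¬q p → ¬q (to (P⇔Q _) p)) v′∼v

module _ {k : ℕ} (C : ℕ → Fin k → Set) (C? : ∀ n j → Dec (C n j))
  (grow : ∀ {n j} → C n j → C (suc n) j) where

  private
    grow* : ∀ {m n j} → m ≤′ n → C m j → C n j
    grow* ≤′-refl       c = c
    grow* (≤′-step m≤n) c = grow (grow* m≤n c)

    someFresh? : (r : Fin (suc k)) → Dec (∃ λ j → C (suc (toℕ r)) j × ¬ C (toℕ r) j)
    someFresh? r = any? λ j → C? (suc (toℕ r)) j ×-dec ¬? (C? (toℕ r) j)

  -- If stability failed at every n ≤ k, each such n would add a fresh coordinate to C,
  -- giving k + 1 distinct coordinates in Fin k.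
  stabilises : ∃ λ n → ∀ j → C (suc n) j → C n j
  stabilises with all? someFresh?
  ... | no ¬alwaysFresh =
    let r , noneFresh = ¬∀⟶∃¬ _ _ someFresh? ¬alwaysFresh
    in toℕ r , λ j c → decidable-stable (C? (toℕ r) j) (λ ¬c → noneFresh (j , c , ¬c))
  ... | yes alwaysFresh with pigeonhole (n<1+n k) (proj₁ ∘ alwaysFresh)
  ...   | r , s , r<s , same =
    let _ , enters , _ = alwaysFresh r
        _ , _ , notYet = alwaysFresh s
    in ⊥-elim (notYet (grow* (≤⇒≤′ r<s) (subst (C (suc (toℕ r))) same enters)))

-- iter f g n y = f⁽ⁿ⁺²⁾(g 0, …, g n, y), spelled out as applyIter unfolds so that the two agree
-- definitionally.
iter : (ℚ → ℚ → ℚ) → (ℕ → ℚ) → ℕ → ℚ → ℚ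
iter f g n y = iterOp f (g 0 ∷ tabulate (λ (l : Fin n) → g (suc (toℕ l))) ++ y ∷ [])

iterTup : (ℚ → ℚ → ℚ) → (Fin k → ℕ → ℚ) → ℕ → Tup k → Tup k
iterTup f c n w j = iter f (c j) n (w j)

iter-snoc : ∀ f g n y → iter f g (suc n) y ≡ iter f g n (f (g (suc n)) y)
iter-snoc f g zero    y = refl
iter-snoc f g (suc n) y = cong (f (g 0)) (iter-snoc f (g ∘ suc) n y)

Frozen : ℚ → (ℕ → ℚ) → ℕ → Set
Frozen q g zero    = g 0 ≤ q
Frozen q g (suc n) = g 0 ≤ q ⊎ Frozen q (g ∘ suc) n

frozen? : ∀ q g n → Dec (Frozen q g n)
frozen? q g zero    = g 0 ≤? q
frozen? q g (suc n) = g 0 ≤? q ⊎-dec frozen? q (g ∘ suc) n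

frozen-suc : ∀ {q g} n → Frozen q g n → Frozen q g (suc n)
frozen-suc zero    = inj₁
frozen-suc (suc n) = [ inj₁ , inj₂ ∘ frozen-suc n ]

frozen-tail : ∀ {q} g n → q < g 0 → Frozen q g (suc n) → Frozen q (g ∘ suc) n
frozen-tail g n q<g₀ = [ ⊥-elim ∘ <⇒≱ q<g₀ , id ]

record Aligned (f : ℚ → ℚ → ℚ) (q : ℚ) {k : ℕ} (a b : Fin k → ℕ → ℚ) (n : ℕ) : Set where
  field
    frozen⇔frozen : ∀ j → Frozen q (a j) n ⇔ Frozen q (b j) n
    some-frozen   : ∃ λ j → Frozen q (a j) n
    aligned       : ∀ u v → SimOn (λ j → Frozen q (a j) n) (iterTup f a n u) (iterTup f b n v)

module PPOrder {f : ℚ → ℚ → ℚ} {q : ℚ} (isPP : IsPPq q f) where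

  pp-≤-low : ∀ {x x′ y y′} → x ≤ q → x ≤ x′ → f x y ≤ f x′ y′
  pp-≤-low x≤q x≤x′ = from (isPP _ _ _ _) (inj₁ (x≤q , x≤x′))

  pp-≤-high : ∀ {x x′ y y′} → q < x → q < x′ → (f x y ≤ f x′ y′) ⇔ (y ≤ y′)
  pp-≤-high q<x q<x′ = mk⇔
    ([ (λ (x≤q , _) → ⊥-elim (<⇒≱ q<x x≤q)) , proj₂ ∘ proj₂ ] ∘ to (isPP _ _ _ _))
    (λ y≤y′ → from (isPP _ _ _ _) (inj₂ (q<x , q<x′ , y≤y′)))

  iter-≤-unfrozen : ∀ {g g′} n {y y′} → ¬ Frozen q g n → ¬ Frozen q g′ n →
    (iter f g n y ≤ iter f g′ n y′) ⇔ (y ≤ y′)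
  iter-≤-unfrozen zero ¬fr ¬fr′ = pp-≤-high (≰⇒> ¬fr) (≰⇒> ¬fr′)
  iter-≤-unfrozen {g} {g′} (suc n) ¬fr ¬fr′ = ⇔.trans
    (pp-≤-high (≰⇒> (¬fr ∘ inj₁)) (≰⇒> (¬fr′ ∘ inj₁)))
    (iter-≤-unfrozen {g ∘ suc} {g′ ∘ suc} n (¬fr ∘ inj₂) (¬fr′ ∘ inj₂))

  iter-≰-frozen : ∀ {g g′} n {y y′} → Frozen q g n → ¬ Frozen q g′ n →
    ¬ (iter f g′ n y′ ≤ iter f g n y)
  iter-≰-frozen zero fr ¬fr′ le with to (isPP _ _ _ _) le
  ... | inj₁ (fr′ , _)      = ¬fr′ fr′
  ... | inj₂ (_ , q<g₀ , _) = <⇒≱ q<g₀ fr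
  iter-≰-frozen {g} {g′} (suc n) fr ¬fr′ le with to (isPP _ _ _ _) le
  ... | inj₁ (fr′ , _)        = ¬fr′ (inj₁ fr′)
  ... | inj₂ (_ , q<g₀ , le′) =
    iter-≰-frozen {g ∘ suc} {g′ ∘ suc} n (frozen-tail g n q<g₀ fr) (¬fr′ ∘ inj₂) le′

  iter-≤-frozen : ∀ {g g′} n {y y′ z z′} → Frozen q g n → Frozen q g′ n →
    iter f g n y ≤ iter f g′ n y′ → iter f g n z ≤ iter f g′ n z′
  iter-≤-frozen zero fr fr′ le with to (isPP _ _ _ _) le
  ... | inj₁ head       = from (isPP _ _ _ _) (inj₁ head)
  ... | inj₂ (q<g₀ , _) = ⊥-elim (<⇒≱ q<g₀ fr)
  iter-≤-frozen {g} {g′} (suc n) fr fr′ le with to (isPP _ _ _ _) le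
  ... | inj₁ head                 = from (isPP _ _ _ _) (inj₁ head)
  ... | inj₂ (q<g₀ , q<g′₀ , le′) = from (isPP _ _ _ _) (inj₂ (q<g₀ , q<g′₀ ,
    iter-≤-frozen {g ∘ suc} {g′ ∘ suc} n (frozen-tail g n q<g₀ fr) (frozen-tail g′ n q<g′₀ fr′) le′))

  iter-≤-frozen⇔ : ∀ {g g′} n {y y′ z z′} → Frozen q g n → Frozen q g′ n →
    (iter f g n y ≤ iter f g′ n y′) ⇔ (iter f g n z ≤ iter f g′ n z′)
  iter-≤-frozen⇔ n fr fr′ = mk⇔ (iter-≤-frozen n fr fr′) (iter-≤-frozen n fr fr′)

  module _ {k : ℕ} {a b : Fin k → ℕ → ℚ} {n : ℕ} (A : Aligned f q a b n) where
    open Aligned A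

    private
      FrozenA : Fin k → Set
      FrozenA j = Frozen q (a j) n

      frozenA? : Decidable FrozenA
      frozenA? j = frozen? q (a j) n

    splits : Σ (Subset k) λ I → Σ ℕ λ m → 1 ℕ.≤ m × m ℕ.≤ k ×
      ∀ u v → Splits (_∈ I) m u v (iterTup f a n u) (iterTup f b n v)
    splits with distinctValues frozenA? (iterTup f a n (const 0ℚ))
    ... | m , D = fromDec frozenA? , m , 1≤m , m≤k ,
                  λ u v → Splits-⇔ (λ i → ⇔.sym (∈-fromDec frozenA? i)) (splitsAt u v)
      where
      1≤m : 1 ℕ.≤ m
      1≤m = DistinctValues-bound D (const (proj₁ some-frozen)) (const (proj₂ some-frozen))
                                 λ { {zero} {zero} _ → refl }
      m≤k : m ℕ.≤ k
      m≤k = injective⇒≤ (distinct D ∘ cong (iterTup f a n (const 0ℚ)))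
      splitsAt : ∀ u v → Splits FrozenA m u v (iterTup f a n u) (iterTup f b n v)
      splitsAt u v = InIm-lowerBlock frozenA? below-u Du , InIm-lowerBlock frozenA? below-v Dv ,
                     aligned u v , unfrozen-u , unfrozen-v
        where
        Du : DistinctValues FrozenA (iterTup f a n u) m
        Du = DistinctValues-transport (λ i j frᵢ frⱼ → iter-≤-frozen⇔ {a i} {a j} n frᵢ frⱼ) D
        Dv : DistinctValues FrozenA (iterTup f b n v) m
        Dv = DistinctValues-transport (aligned u v) Du
        below-u : ∀ {i j} → FrozenA i → ¬ FrozenA j → iterTup f a n u i < iterTup f a n u j
        below-u {i} {j} frᵢ ¬frⱼ = ≰⇒> (iter-≰-frozen {a i} {a j} n frᵢ ¬frⱼ)
        below-v : ∀ {i j} → FrozenA i → ¬ FrozenA j → iterTup f b n v i < iterTup f b n v j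
        below-v {i} {j} frᵢ ¬frⱼ = ≰⇒> (iter-≰-frozen {b i} {b j} n
          (to (frozen⇔frozen i) frᵢ) (¬frⱼ ∘ from (frozen⇔frozen j)))
        unfrozen-u : SimOn (λ i → ¬ FrozenA i) (iterTup f a n u) u
        unfrozen-u i j ¬frᵢ ¬frⱼ = iter-≤-unfrozen {a i} {a j} n ¬frᵢ ¬frⱼ
        unfrozen-v : SimOn (λ i → ¬ FrozenA i) (iterTup f b n v) v
        unfrozen-v i j ¬frᵢ ¬frⱼ = iter-≤-unfrozen {b i} {b j} n
          (¬frᵢ ∘ from (frozen⇔frozen i)) (¬frⱼ ∘ from (frozen⇔frozen j))

module BackwardPath {k : ℕ} {E : BinRel k} (smooth : Smooth E) {u₁ v₁ : Tup k} (e : E u₁ v₁) where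

  private
    walk : ℕ → Σ (Tup k) λ x → ∃ (E x)
    walk zero    = u₁ , v₁ , e
    walk (suc l) =
      let x , x∈dom = walk l
          y , y→x   = to (smooth x) x∈dom
      in y , x , y→x

  path : ℕ → Tup k
  path = proj₁ ∘ walk

  path-edge : ∀ l → E (path (suc l)) (path l)
  path-edge l = proj₂ (proj₂ (walk (suc l)))

Smooth-flip : {E : BinRel k} → Smooth E → Smooth (flip E)
Smooth-flip smooth x = ⇔.sym (smooth x)

Conclusion : (ℚ → ℚ → ℚ → ℚ) → {k : ℕ} → BinRel k → Tup k → Tup k → Set
Conclusion pp {k} E u₁ v₁ =
  Σ (Subset k) λ I → Σ ℕ λ m → 1 ℕ.≤ m × m ℕ.≤ k × Σ ℚ λ q → Σ ℕ λ n →
  Σ (Fin n → Tup k × Tup k) λ ws → (∀ l → E (proj₁ (ws l)) (proj₂ (ws l))) ×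
  ∀ u v → Splits (_∈ I) m u v (applyIter (pp q) u₁ (proj₁ ∘ ws) u)
                               (applyIter (pp q) v₁ (proj₂ ∘ ws) v)

Conclusion-flip : ∀ {pp} (E : BinRel k) → Conclusion pp (flip E) v u → Conclusion pp E u v
Conclusion-flip E (I , m , 1≤m , m≤k , q , n , ws , edges , split) =
  I , m , 1≤m , m≤k , q , n , swap ∘ ws , edges , λ u v → Splits-swap (split v u)

module _ (pp : ℚ → ℚ → ℚ → ℚ) (isPP : ∀ q → IsPPq q (pp q)) {k : ℕ} (E : BinRel k) where

  conclusion : ∀ q (a b : Fin k → ℕ → ℚ) n →
    (∀ (l : Fin n) → E (λ j → a j (suc (toℕ l))) (λ j → b j (suc (toℕ l)))) →
    Aligned (pp q) q a b n → Conclusion pp E (λ j → a j 0) (λ j → b j 0)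
  conclusion q a b n edges A =
    let I , m , 1≤m , m≤k , split = PPOrder.splits (isPP q) A
        ws = λ l → (λ j → a j (suc (toℕ l))) , (λ j → b j (suc (toℕ l)))
    in I , m , 1≤m , m≤k , q , n , ws , edges , split

  -- Once the frozen set has settled at n, the last entry x (n + 1) of the u-row no longer matters,
  -- and the leading entry v₁ > q of the v-row never does.
  conclusion-path : ∀ {q} (x : ℕ → Tup k) → (∀ l → E (x (suc l)) (x l)) →
    ∀ {v₁ j₀} → x 0 j₀ ≤ q → (∀ j → q < v₁ j) → Conclusion pp E (x 0) v₁
  conclusion-path {q} x edge {v₁} {j₀} x₀≤q q<v₁
    with stabilises (λ n j → Frozen q (λ l → x l j) n) (λ n j → frozen? q (λ l → x l j) n)
                    (frozen-suc _)
  ... | n , settled = conclusion q uColumn vColumn (suc n) (edge ∘ toℕ) record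
    { frozen⇔frozen = λ j → mk⇔ (inj₂ ∘ settled j) [ ⊥-elim ∘ <⇒≱ (q<v₁ j) , frozen-suc n ]
    ; some-frozen   = j₀ , inj₁ x₀≤q
    ; aligned       = aligned
    }
    where
    open PPOrder (isPP q)
    uColumn : Fin k → ℕ → ℚ
    uColumn j l = x l j
    vColumn : Fin k → ℕ → ℚ
    vColumn j zero    = v₁ j
    vColumn j (suc l) = x l j
    aligned : ∀ u v → SimOn (λ j → Frozen q (uColumn j) (suc n))
      (iterTup (pp q) uColumn (suc n) u) (iterTup (pp q) vColumn (suc n) v)
    aligned u v i j frᵢ frⱼ = subst₂ (λ y y′ → (y ≤ y′) ⇔ (vRow i ≤ vRow j))
        (sym (iter-snoc (pp q) (uColumn i) n (u i))) (sym (iter-snoc (pp q) (uColumn j) n (u j)))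
        (⇔.trans (iter-≤-frozen⇔ {uColumn i} {uColumn j} n (settled i frᵢ) (settled j frⱼ))
                 (⇔.sym (pp-≤-high (q<v₁ i) (q<v₁ j))))
      where
      vRow : Tup k
      vRow = iterTup (pp q) vColumn (suc n) v

  conclusion-≡ : ∀ {q} → MinClean u v → IsMin u q → IsMin v q → Conclusion pp E u v
  conclusion-≡ {u} {v} {q} clean min-u min-v = conclusion q (λ j _ → u j) (λ j _ → v j) 0 (λ ()) record
    { frozen⇔frozen = same-minx
    ; some-frozen   = proj₁ (proj₁ min-u) , ≤-reflexive (proj₂ (proj₁ min-u))
    ; aligned       = λ _ _ i j uᵢ≤q _ → let vᵢ≤q = to (same-minx i) uᵢ≤q in mk⇔
        (const (pp-≤-low vᵢ≤q (≤-trans vᵢ≤q (proj₂ min-v j))))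
        (const (pp-≤-low uᵢ≤q (≤-trans uᵢ≤q (proj₂ min-u j))))
    }
    where
    open PPOrder (isPP q)
    InMinx⇔≤min : ∀ {a x i} → IsMin a x → InMinx a i ⇔ (a i ≤ x)
    InMinx⇔≤min ((i₀ , aᵢ₀≡x) , x≤a) =
      mk⇔ (λ minimal → ≤-trans (minimal i₀) (≤-reflexive aᵢ₀≡x)) (λ aᵢ≤x j → ≤-trans aᵢ≤x (x≤a j))
    same-minx : ∀ j → (u j ≤ q) ⇔ (v j ≤ q)
    same-minx j = ⇔.trans (⇔.sym (InMinx⇔≤min min-u))
      (⇔.trans (clean q (inj₁ (proj₁ min-u) , λ i → proj₂ min-u i , proj₂ min-v i) min-u min-v j)
               (InMinx⇔≤min min-v))

minimum : (a : Tup (suc k)) → ∃ (IsMin a)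
minimum {k} a = a i , (i , refl) , λ j → All.lookup i-minimal (∈-allFin j)
  where
  i : Fin (suc k)
  i = argmin a zero (allFin (suc k))
  i-minimal : All.All (λ j → a i ≤ a j) (allFin (suc k))
  i-minimal = f[argmin]≤f[xs] zero (allFin (suc k))

conclusion-minima : ∀ pp → (∀ q → IsPPq q (pp q)) → (E : BinRel k) → Smooth E → E u v → MinClean u v →
  ∀ {q q′} → IsMin u q → IsMin v q′ → Conclusion pp E u v
conclusion-minima pp isPP E smooth e clean {q} {q′} min-u min-v with <-cmp q q′
... | tri< q<q′ _ _ = conclusion-path pp isPP E
  (BackwardPath.path smooth e) (BackwardPath.path-edge smooth e)
  (≤-reflexive (proj₂ (proj₁ min-u))) (λ j → <-≤-trans q<q′ (proj₂ min-v j))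
... | tri≈ _ refl _ = conclusion-≡ pp isPP E clean min-u min-v
... | tri> _ _ q′<q = Conclusion-flip E (conclusion-path pp isPP (flip E)
  (BackwardPath.path (Smooth-flip smooth) e) (BackwardPath.path-edge (Smooth-flip smooth) e)
  (≤-reflexive (proj₂ (proj₁ min-v))) (λ j → <-≤-trans q′<q (proj₂ min-u j)))

lemma3p3 : (pp : ℚ → ℚ → ℚ → ℚ) → (∀ q → IsPPq q (pp q)) →
    (k : ℕ) → 1 ℕ.≤ k → (E : BinRel k) → Smooth E → PreservedByClo (pp 0ℚ) E →
    (u1 v1 : Tup k) → E u1 v1 → MinClean u1 v1 →
    Σ (Subset k) λ I → Σ ℕ λ m → 1 ℕ.≤ m × m ℕ.≤ k × Σ ℚ λ q → Σ ℕ λ n' →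
      Σ (Fin n' → Tup k × Tup k) λ ws → (∀ l → E (proj₁ (ws l)) (proj₂ (ws l))) ×
      (∀ (u v : Tup k) →
        let u' = applyIter (pp q) u1 (λ l → proj₁ (ws l)) u
            v' = applyIter (pp q) v1 (λ l → proj₂ (ws l)) v
        in (∀ i → InIm m u' i ⇔ i ∈ I) × (∀ i → InIm m v' i ⇔ i ∈ I) ×
           SimOn (λ i → i ∈ I) u' v' ×
           SimOn (λ i → i ∉ I) u' u × SimOn (λ i → i ∉ I) v' v)
lemma3p3 pp isPP (suc k) _ E smooth _ u1 v1 e clean =
  conclusion-minima pp isPP E smooth e clean (proj₂ (minimum u1)) (proj₂ (minimum v1))
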